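{- Let $r\ge 1$ be an integer, let $G$ be an $r$-regular graph on $n$ vertices, and let $\mu>0$. Then \[ D_G(\mu)\le D_{K_{r+1}}(\mu)^{n/(r+1)}\qquad\text{and}\qquad D^s_G(\mu)\le D^s_{K_{r,r}}(\mu)^{n/(2r)}. \]
   Context: All graphs are finite and simple. For a vertex $v$, $N(v)$ is its set of neighbors and $N[v]=N(v)\cup\{v\}$; for $S\subseteq V(G)$, $N(S)=\bigcup_{v\in S}N(v)$ and $N[S]=\bigcup_{v\in S}N[v]$. A set $S\subseteq V(G)$ is a dominating set if $N[S]=V(G)$, and a strong dominating set if $N(S)=V(G)$. Let $\operatorname{ds}_k(G)$ and $\operatorname{sds}_k(G)$ denote the numbers of dominating sets and strong dominating sets of $G$ of size $k$. The dominating set polynomial is $D_G(\mu)=\sum_k \operatorname{ds}_k(G)\mu^k$ and the strong dominating set polynomial is $D^s_G(\mu)=\sum_k\operatorname{sds}_k(G)\mu^k$. $K_{r+1}$ is the complete graph on $r+1$ vertices and $K_{r,r}$ the complete bipartite graph with parts of size $r$.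
   Formalization: The parameter μ ranges over the positive rationals. -}

module Defs where

open import Data.Bool using (Bool; true; false; _∧_; _∨_; not; _xor_; if_then_else_)
open import Data.Nat using (ℕ; zero; suc; _+_; _<ᵇ_)
open import Data.Fin using (Fin; toℕ; _≟_)
open import Data.Vec using (Vec; []; _∷_; lookup)
open import Data.List using (List; []; _∷_; map; _++_; filter; length; upTo; foldr)
open import Data.Product using (_×_)
open import Relation.Nullary.Decidable using (⌊_⌋)
open import Relation.Binary.PropositionalEquality using (_≡_)
open import Data.Rational using (ℚ; 0ℚ; 1ℚ; _*_) renaming (_+_ to _+ℚ_)
open import Data.Rational using () renaming (_/_ to _/ℚ_)
open import Data.Integer using (+_)

record Graph (n : ℕ) : Set where
  field
    adj   : Fin n → Fin n → Bool
    adj-sym : ∀ i j → adj i j ≡ adj j i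
    adj-irrefl : ∀ i → adj i i ≡ false
open Graph public

allFin : (n : ℕ) → List (Fin n)
allFin n = Data.List.tabulate {n = n} (λ i → i)
  where import Data.List

anyV : ∀ {n} → (Fin n → Bool) → Bool
anyV {n} p = foldr (λ i b → p i ∨ b) false (allFin n)

allV : ∀ {n} → (Fin n → Bool) → Bool
allV {n} p = foldr (λ i b → p i ∧ b) true (allFin n)

countV : ∀ {n} → (Fin n → Bool) → ℕ
countV {n} p = length (filter (λ i → p i Data.Bool.≟ true) (allFin n))
  where import Data.Bool

degree : ∀ {n} → Graph n → Fin n → ℕ
degree G v = countV (adj G v)

Regular : ∀ {n} → ℕ → Graph n → Set
Regular r G = ∀ v → degree G v ≡ r

Subset : ℕ → Set
Subset n = Vec Bool n

allSubsets : (n : ℕ) → List (Subset n)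
allSubsets zero = [] ∷ []
allSubsets (suc n) = map (true ∷_) (allSubsets n) ++ map (false ∷_) (allSubsets n)

size : ∀ {n} → Subset n → ℕ
size S = countV (lookup S)

isDominating : ∀ {n} → Graph n → Subset n → Bool
isDominating G S = allV (λ v → lookup S v ∨ anyV (λ u → lookup S u ∧ adj G u v))

isStrongDominating : ∀ {n} → Graph n → Subset n → Bool
isStrongDominating G S = allV (λ v → anyV (λ u → lookup S u ∧ adj G u v))

countSets : ∀ {n} → (Subset n → Bool) → ℕ → ℕ
countSets {n} p k =
  length (filter (λ S → (p S ∧ ⌊ size S Data.Nat.≟ k ⌋) Data.Bool.≟ true) (allSubsets n))
  where import Data.Bool ; import Data.Nat

ds : ∀ {n} → Graph n → ℕ → ℕ
ds G = countSets (isDominating G)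

sds : ∀ {n} → Graph n → ℕ → ℕ
sds G = countSets (isStrongDominating G)

fromℕ : ℕ → ℚ
fromℕ m = (+ m) /ℚ 1

infixr 8 _^_
_^_ : ℚ → ℕ → ℚ
x ^ zero = 1ℚ
x ^ suc m = x * (x ^ m)

evalPoly : ℕ → (ℕ → ℕ) → ℚ → ℚ
evalPoly n c μ = foldr (λ k acc → (fromℕ (c k) * (μ ^ k)) +ℚ acc) 0ℚ (upTo (suc n))

-- D_G(μ) and D^s_G(μ)  (sizes of subsets are at most n)
D : ∀ {n} → Graph n → ℚ → ℚ
D {n} G = evalPoly n (ds G)

Ds : ∀ {n} → Graph n → ℚ → ℚ
Ds {n} G = evalPoly n (sds G)

complete : (m : ℕ) → Graph m
complete m = record
  { adj = λ i j → not ⌊ i ≟ j ⌋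
  ; adj-sym = symK
  ; adj-irrefl = irrK }
  where
  open import Relation.Nullary using (yes; no)
  open import Relation.Binary.PropositionalEquality using (refl; sym)
  open import Data.Empty using (⊥-elim)
  symK : ∀ i j → not ⌊ i ≟ j ⌋ ≡ not ⌊ j ≟ i ⌋
  symK i j with i ≟ j | j ≟ i
  ... | yes _ | yes _ = refl
  ... | no _ | no _ = refl
  ... | yes p | no q = ⊥-elim (q (sym p))
  ... | no p | yes q = ⊥-elim (p (sym q))
  irrK : ∀ i → not ⌊ i ≟ i ⌋ ≡ false
  irrK i with i ≟ i
  ... | yes _ = refl
  ... | no p = ⊥-elim (p refl)

side : ∀ {r} → Fin (r + r) → Bool
side {r} i = toℕ i <ᵇ r

completeBipartite : (r : ℕ) → Graph (r + r)
completeBipartite r = record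
  { adj = λ i j → side {r} i xor side {r} j
  ; adj-sym = λ i j → xorComm (side {r} i) (side {r} j)
  ; adj-irrefl = λ i → xorSelf (side {r} i) }
  where
  open import Relation.Binary.PropositionalEquality using (refl)
  xorComm : ∀ a b → (a xor b) ≡ (b xor a)
  xorComm true true = refl
  xorComm true false = refl
  xorComm false true = refl
  xorComm false false = refl
  xorSelf : ∀ a → (a xor a) ≡ false
  xorSelf true = refl
  xorSelf false = refl

module Submission where

-- A set S dominates G iff it meets every closed neighbourhood N[v], and
-- strongly dominates G iff it meets every open neighbourhood N(v).  Both are
-- covering systems: lists of supports A ⊆ V which S must meet.  For such a
-- system let Z = Σ { μ^|S| : S meets every support }.  If every vertex lies in
-- exactly k+1 supports then Z^{k+1} ≤ Π_A ((1+μ)^|A| - 1)  (Z-bound), by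
-- induction on the vertices: fixing the first vertex in or out of S splits Z
-- into two systems, whose bounds are recombined by a root-free two-term Hölder
-- inequality (holder₂, derived from AM–GM).  If every vertex lies in exactly one
-- support the constraints are independent and equality holds (Z-exact); this
-- evaluates the polynomials of K_{r+1} and K_{r,r}.  In an r-regular graph the
-- closed (open) neighbourhoods have size r+1 (r) and every vertex lies in r+1
-- (r) of them; the strong bound is finally squared to reach the exponent 2r.

open import Defs

open import Data.Nat using (ℕ; zero; suc; _+_; _≥_; _<ᵇ_; z≤n; s≤s)
import Data.Nat as ℕ
import Data.Nat.Properties as ℕₚ
open import Data.Rational using (ℚ; mkℚ; 0ℚ; 1ℚ; _≤_; _<_; _*_; _-_; -_; _≤?_; _/_; 1/_; NonZero; positive; nonNegative)
  renaming (_+_ to _+ℚ_)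
import Data.Rational.Properties as ℚₚ
import Data.Integer as ℤ
import Data.Integer.Properties as ℤₚ
import Data.Sign as Sign
import Data.Nat.Coprimality as Coprime
open import Data.Rational.Solver using (module +-*-Solver)
open import Data.Product using (_×_; _,_; proj₁; proj₂; Σ)
open import Data.Bool using (Bool; true; false; _∧_; _∨_; _xor_; if_then_else_)
import Data.Bool.Properties as 𝔹
open import Data.Fin using (Fin; toℕ; _≟_) renaming (zero to fzero; suc to fsuc)
open import Data.Vec using (Vec; []; _∷_; lookup; tabulate)
import Data.Vec.Properties as Vecₚ
import Data.Vec.Functional as VF
open import Data.Sum using (_⊎_; inj₁; inj₂)
open import Data.Empty using (⊥-elim)
open import Function using (_∘_)
open import Relation.Nullary using (¬_; yes; no)
open import Relation.Nullary.Decidable using (⌊_⌋)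
open import Relation.Binary.Definitions using (tri<; tri≈; tri>)
open import Relation.Binary.PropositionalEquality
open import Data.List using (List; []; _∷_; length; map; upTo)
import Data.List as List
import Data.List.Properties as Listₚ
open import Data.List.Relation.Unary.All using (All; []; _∷_)

open +-*-Solver using (solve; _:+_; _:*_; _:-_; :-_; _:=_; con)

NonNeg : ℚ → Set
NonNeg x = 0ℚ ≤ x

0≤1 : NonNeg 1ℚ
0≤1 = ℚₚ.<⇒≤ (ℚₚ.positive⁻¹ 1ℚ)

+-nonNeg : ∀ {a b} → NonNeg a → NonNeg b → NonNeg (a +ℚ b)
+-nonNeg {a} {b} 0≤a 0≤b = subst (_≤ a +ℚ b) (ℚₚ.+-identityʳ 0ℚ) (ℚₚ.+-mono-≤ 0≤a 0≤b)

*-nonNeg : ∀ {a b} → NonNeg a → NonNeg b → NonNeg (a * b)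
*-nonNeg {a} {b} 0≤a 0≤b = subst (_≤ a * b) (ℚₚ.*-zeroʳ a) (ℚₚ.*-monoˡ-≤-nonNeg a {{nonNegative 0≤a}} 0≤b)

*-monoˡ : ∀ {a b} c → NonNeg c → a ≤ b → c * a ≤ c * b
*-monoˡ c 0≤c = ℚₚ.*-monoˡ-≤-nonNeg c {{nonNegative 0≤c}}

*-monoʳ : ∀ {a b} c → NonNeg c → a ≤ b → a * c ≤ b * c
*-monoʳ c 0≤c = ℚₚ.*-monoʳ-≤-nonNeg c {{nonNegative 0≤c}}

*-mono : ∀ {a b c d} → NonNeg b → NonNeg c → a ≤ b → c ≤ d → a * c ≤ b * d
*-mono {c = c} 0≤b 0≤c a≤b c≤d = ℚₚ.≤-trans (*-monoʳ c 0≤c a≤b) (*-monoˡ _ 0≤b c≤d)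

*-pos : ∀ {a b} → 0ℚ < a → 0ℚ < b → 0ℚ < a * b
*-pos {a} {b} 0<a 0<b = subst (_< a * b) (ℚₚ.*-zeroʳ a) (ℚₚ.*-monoʳ-<-pos a {{positive 0<a}} 0<b)

*-strictˡ : ∀ {a b} c → 0ℚ < c → a < b → c * a < c * b
*-strictˡ c 0<c = ℚₚ.*-monoʳ-<-pos c {{positive 0<c}}

<⇒≱ : ∀ {a b} → a < b → ¬ (b ≤ a)
<⇒≱ a<b b≤a = ℚₚ.<-irrefl refl (ℚₚ.≤-<-trans b≤a a<b)

-- a ≤ b is equivalent to 0 ≤ b - a; inequalities are proved below by
-- exhibiting b - a as a manifestly nonnegative expression.
nonNeg-diff⇒≤ : ∀ {a b} → NonNeg (b - a) → a ≤ b
nonNeg-diff⇒≤ {a} {b} 0≤b-a = subst₂ _≤_ (ℚₚ.+-identityʳ a) a+[b-a]≡b (ℚₚ.+-monoʳ-≤ a 0≤b-a)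
  where
  a+[b-a]≡b : a +ℚ (b - a) ≡ b
  a+[b-a]≡b = solve 2 (λ a b → a :+ (b :- a) := b) refl a b

≤⇒nonNeg-diff : ∀ {a b} → a ≤ b → NonNeg (b - a)
≤⇒nonNeg-diff {a} {b} a≤b = subst (_≤ b - a) (ℚₚ.+-inverseʳ a) (ℚₚ.+-monoˡ-≤ (- a) a≤b)

square-nonNeg : ∀ d → NonNeg (d * d)
square-nonNeg d with ℚₚ.≤-total 0ℚ d
... | inj₁ 0≤d = *-nonNeg 0≤d 0≤d
... | inj₂ d≤0 = subst NonNeg (solve 1 (λ d → (:- d) :* (:- d) := d :* d) refl d) (*-nonNeg 0≤-d 0≤-d)
  where
  0≤-d : NonNeg (- d)
  0≤-d = subst₂ _≤_ (ℚₚ.+-inverseʳ d) (ℚₚ.+-identityˡ (- d)) (ℚₚ.+-monoˡ-≤ (- d) d≤0)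

zero-or-pos : ∀ {a} → NonNeg a → (a ≡ 0ℚ) ⊎ (0ℚ < a)
zero-or-pos {a} 0≤a with ℚₚ.<-cmp 0ℚ a
... | tri< 0<a _ _ = inj₂ 0<a
... | tri≈ _ 0≡a _ = inj₁ (sym 0≡a)
... | tri> _ _ a<0 = ⊥-elim (<⇒≱ a<0 0≤a)

+-nonNeg-zero : ∀ {a b} → NonNeg a → NonNeg b → a +ℚ b ≡ 0ℚ → a ≡ 0ℚ
+-nonNeg-zero {a} {b} 0≤a 0≤b a+b≡0 =
  ℚₚ.≤-antisym (subst (a ≤_) a+b≡0 (subst (_≤ a +ℚ b) (ℚₚ.+-identityʳ a) (ℚₚ.+-monoʳ-≤ a 0≤b))) 0≤a

^-nonNeg : ∀ {a} k → NonNeg a → NonNeg (a ^ k)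
^-nonNeg zero    0≤a = 0≤1
^-nonNeg (suc k) 0≤a = *-nonNeg 0≤a (^-nonNeg k 0≤a)

^-pos : ∀ {a} k → 0ℚ < a → 0ℚ < a ^ k
^-pos zero    0<a = ℚₚ.positive⁻¹ 1ℚ
^-pos (suc k) 0<a = *-pos 0<a (^-pos k 0<a)

^-distrib-* : ∀ a b k → (a * b) ^ k ≡ a ^ k * b ^ k
^-distrib-* a b zero    = refl
^-distrib-* a b (suc k) rewrite ^-distrib-* a b k =
  solve 4 (λ a b x y → (a :* b) :* (x :* y) := (a :* x) :* (b :* y)) refl a b (a ^ k) (b ^ k)

^-+ : ∀ a m k → a ^ (m + k) ≡ a ^ m * a ^ k
^-+ a zero    k = sym (ℚₚ.*-identityˡ _)
^-+ a (suc m) k rewrite ^-+ a m k = sym (ℚₚ.*-assoc a (a ^ m) (a ^ k))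

1^ : ∀ k → 1ℚ ^ k ≡ 1ℚ
1^ zero    = refl
1^ (suc k) rewrite 1^ k = refl

0^suc : ∀ k → 0ℚ ^ suc k ≡ 0ℚ
0^suc k = ℚₚ.*-zeroˡ (0ℚ ^ k)

^-mono : ∀ {a b} k → NonNeg a → a ≤ b → a ^ k ≤ b ^ k
^-mono zero    0≤a a≤b = ℚₚ.≤-refl
^-mono (suc k) 0≤a a≤b = *-mono (ℚₚ.≤-trans 0≤a a≤b) (^-nonNeg k 0≤a) a≤b (^-mono k 0≤a a≤b)

^-strict : ∀ {a b} k → NonNeg a → a < b → a ^ suc k < b ^ suc k
^-strict {a} {b} zero 0≤a a<b = subst₂ _<_ (sym (ℚₚ.*-identityʳ a)) (sym (ℚₚ.*-identityʳ b)) a<b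
^-strict {a} {b} (suc k) 0≤a a<b =
  ℚₚ.≤-<-trans (*-monoʳ (a ^ suc k) (^-nonNeg (suc k) 0≤a) (ℚₚ.<⇒≤ a<b))
               (*-strictˡ b (ℚₚ.≤-<-trans 0≤a a<b) (^-strict k 0≤a a<b))

-- A positive power is strictly monotone on nonnegatives, so it can be cancelled.
^-cancel-< : ∀ {a b} k → NonNeg b → a ^ suc k < b ^ suc k → a < b
^-cancel-< {a} {b} k 0≤b aᵏ<bᵏ with b ≤? a
... | yes b≤a = ⊥-elim (<⇒≱ aᵏ<bᵏ (^-mono (suc k) 0≤b b≤a))
... | no  b≰a = ℚₚ.≰⇒> b≰a

^-cancel-≤ : ∀ {a b} k → NonNeg b → a ^ suc k ≤ b ^ suc k → a ≤ b
^-cancel-≤ {a} {b} k 0≤b aᵏ≤bᵏ with a ≤? b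
... | yes a≤b = a≤b
... | no  a≰b = ⊥-elim (<⇒≱ (^-strict k 0≤b (ℚₚ.≰⇒> a≰b)) aᵏ≤bᵏ)

^-bound-squared : ∀ {x y} r n → NonNeg x → x ^ r ≤ y ^ n → x ^ (r + r) ≤ (y * y) ^ n
^-bound-squared {x} {y} r n 0≤x xʳ≤yⁿ = begin
  x ^ (r + r)         ≡⟨ ^-+ x r r ⟩
  x ^ r * x ^ r       ≤⟨ *-mono (ℚₚ.≤-trans 0≤xʳ xʳ≤yⁿ) 0≤xʳ xʳ≤yⁿ xʳ≤yⁿ ⟩
  y ^ n * y ^ n       ≡⟨ ^-distrib-* y y n ⟨
  (y * y) ^ n         ∎
  where
  open ℚₚ.≤-Reasoning
  0≤xʳ = ^-nonNeg r 0≤x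

sumℚ : List ℚ → ℚ
sumℚ []       = 0ℚ
sumℚ (x ∷ xs) = x +ℚ sumℚ xs

prodℚ : List ℚ → ℚ
prodℚ []       = 1ℚ
prodℚ (x ∷ xs) = x * prodℚ xs

sumℚ-nonNeg : ∀ {xs} → All NonNeg xs → NonNeg (sumℚ xs)
sumℚ-nonNeg []           = ℚₚ.≤-refl
sumℚ-nonNeg (0≤x ∷ 0≤xs) = +-nonNeg 0≤x (sumℚ-nonNeg 0≤xs)

sumℚ-++ : ∀ xs ys → sumℚ (xs List.++ ys) ≡ sumℚ xs +ℚ sumℚ ys
sumℚ-++ []       ys = sym (ℚₚ.+-identityˡ _)
sumℚ-++ (x ∷ xs) ys rewrite sumℚ-++ xs ys = sym (ℚₚ.+-assoc x (sumℚ xs) (sumℚ ys))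

sumℚ-scale : ∀ {A : Set} c (f : A → ℚ) xs → sumℚ (map (λ x → c * f x) xs) ≡ c * sumℚ (map f xs)
sumℚ-scale c f []       = sym (ℚₚ.*-zeroʳ c)
sumℚ-scale c f (x ∷ xs) rewrite sumℚ-scale c f xs = sym (ℚₚ.*-distribˡ-+ c (f x) (sumℚ (map f xs)))

sumℚ-cong : ∀ {A : Set} {f g : A → ℚ} → (∀ x → f x ≡ g x) → ∀ xs → sumℚ (map f xs) ≡ sumℚ (map g xs)
sumℚ-cong f≗g xs = cong sumℚ (Listₚ.map-cong f≗g xs)

sumℚ-+ : ∀ {A : Set} (f g : A → ℚ) xs → sumℚ (map (λ x → f x +ℚ g x) xs) ≡ sumℚ (map f xs) +ℚ sumℚ (map g xs)
sumℚ-+ f g []       = sym (ℚₚ.+-identityʳ 0ℚ)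
sumℚ-+ f g (x ∷ xs) rewrite sumℚ-+ f g xs =
  solve 4 (λ a b c d → (a :+ b) :+ (c :+ d) := (a :+ c) :+ (b :+ d)) refl (f x) (g x) (sumℚ (map f xs)) (sumℚ (map g xs))

sumℚ-zero : ∀ {A : Set} (xs : List A) → sumℚ (map (λ _ → 0ℚ) xs) ≡ 0ℚ
sumℚ-zero []       = refl
sumℚ-zero (x ∷ xs) = trans (ℚₚ.+-identityˡ _) (sumℚ-zero xs)

sumℚ-swap : ∀ {A B : Set} (f : A → B → ℚ) xs ys →
            sumℚ (map (λ x → sumℚ (map (f x) ys)) xs) ≡ sumℚ (map (λ y → sumℚ (map (λ x → f x y) xs)) ys)
sumℚ-swap f []       ys = sym (sumℚ-zero ys)
sumℚ-swap f (x ∷ xs) ys rewrite sumℚ-swap f xs ys = sym (sumℚ-+ (f x) (λ y → sumℚ (map (λ x → f x y) xs)) ys)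

sumℚ-upTo-suc : ∀ (f : ℕ → ℚ) N → sumℚ (map f (upTo (suc N))) ≡ sumℚ (map f (upTo N)) +ℚ f N
sumℚ-upTo-suc f N = begin
  sumℚ (map f (upTo (suc N)))           ≡⟨ cong (sumℚ ∘ map f) (Listₚ.upTo-∷ʳ N) ⟨
  sumℚ (map f (upTo N List.++ N ∷ []))  ≡⟨ cong sumℚ (Listₚ.map-++ f (upTo N) (N ∷ [])) ⟩
  sumℚ (map f (upTo N) List.++ f N ∷ []) ≡⟨ sumℚ-++ (map f (upTo N)) (f N ∷ []) ⟩
  sumℚ (map f (upTo N)) +ℚ (f N +ℚ 0ℚ)  ≡⟨ cong (sumℚ (map f (upTo N)) +ℚ_) (ℚₚ.+-identityʳ (f N)) ⟩
  sumℚ (map f (upTo N)) +ℚ f N          ∎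
  where open ≡-Reasoning

foldr-+≡sumℚ : ∀ {A : Set} (f : A → ℚ) xs → List.foldr (λ x acc → f x +ℚ acc) 0ℚ xs ≡ sumℚ (map f xs)
foldr-+≡sumℚ f []       = refl
foldr-+≡sumℚ f (x ∷ xs) = cong (f x +ℚ_) (foldr-+≡sumℚ f xs)

fromℕ-suc : ∀ m → fromℕ (suc m) ≡ 1ℚ +ℚ fromℕ m
fromℕ-suc m = sym (begin
  1ℚ +ℚ fromℕ m                                          ≡⟨ cong (1ℚ +ℚ_) (ℚₚ.normalize-coprime m-coprime-1) ⟩
  1ℚ +ℚ mkℚ (ℤ.+ m) 0 m-coprime-1                       ≡⟨⟩
  (ℤ.+ 1 ℤ.+ (Sign.+ ℤ.◃ (m ℕ.* 1))) / 1               ≡⟨ cong (λ z → (ℤ.+ 1 ℤ.+ z) / 1) m◃1≡m ⟩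
  fromℕ (suc m)                                          ∎)
  where
  open ≡-Reasoning
  m-coprime-1 : Coprime.Coprime m 1
  m-coprime-1 = Coprime.sym (Coprime.1-coprimeTo m)
  m◃1≡m : Sign.+ ℤ.◃ (m ℕ.* 1) ≡ ℤ.+ m
  m◃1≡m = trans (ℤₚ.+◃n≡+n (m ℕ.* 1)) (cong ℤ.+_ (ℕₚ.*-identityʳ m))

fromℕ-nonNeg : ∀ m → NonNeg (fromℕ m)
fromℕ-nonNeg zero    = ℚₚ.≤-refl
fromℕ-nonNeg (suc m) = subst NonNeg (sym (fromℕ-suc m)) (+-nonNeg 0≤1 (fromℕ-nonNeg m))

fromℕ-pos : ∀ m → 0ℚ < fromℕ (suc m)
fromℕ-pos m = ℚₚ.<-≤-trans (ℚₚ.positive⁻¹ 1ℚ)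
  (subst (1ℚ ≤_) (sym (fromℕ-suc m))
    (subst (_≤ 1ℚ +ℚ fromℕ m) (ℚₚ.+-identityʳ 1ℚ) (ℚₚ.+-monoʳ-≤ 1ℚ (fromℕ-nonNeg m))))

-- The two-variable weighted AM–GM inequality in polynomial form:
-- (k+1)·b·aᵏ ≤ bᵏ⁺¹ + k·aᵏ⁺¹ for a, b ≥ 0.  The step k ↦ k+1 adds
-- b·(previous gap) + (k+1)·aᵏ·(b-a)² to the gap.
weighted-am-gm : ∀ {a b} → NonNeg a → NonNeg b → ∀ k →
                 fromℕ (suc k) * b * a ^ k ≤ b ^ suc k +ℚ fromℕ k * a ^ suc k
weighted-am-gm {a} {b} 0≤a 0≤b zero = ℚₚ.≤-reflexive
  (solve 2 (λ a b → con 1ℚ :* b :* con 1ℚ := b :* con 1ℚ :+ con 0ℚ :* (a :* con 1ℚ)) refl a b)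
weighted-am-gm {a} {b} 0≤a 0≤b (suc k) rewrite fromℕ-suc (suc k) | fromℕ-suc k =
  nonNeg-diff⇒≤ (subst NonNeg (sym gap-step)
    (+-nonNeg (*-nonNeg 0≤b (≤⇒nonNeg-diff previous))
              (*-nonNeg (*-nonNeg (ℚₚ.<⇒≤ k+1>0) (^-nonNeg k 0≤a)) (square-nonNeg (b - a)))))
  where
  K = fromℕ k
  k+1>0 : 0ℚ < 1ℚ +ℚ K
  k+1>0 = subst (0ℚ <_) (fromℕ-suc k) (fromℕ-pos k)
  previous : (1ℚ +ℚ K) * b * a ^ k ≤ b ^ suc k +ℚ K * a ^ suc k
  previous = subst (λ k+1 → k+1 * b * a ^ k ≤ b ^ suc k +ℚ K * a ^ suc k) (fromℕ-suc k)
               (weighted-am-gm 0≤a 0≤b k)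
  gap-step : (b * (b * b ^ k) +ℚ (1ℚ +ℚ K) * (a * (a * a ^ k))) - (1ℚ +ℚ (1ℚ +ℚ K)) * b * (a * a ^ k)
           ≡ b * ((b * b ^ k +ℚ K * (a * a ^ k)) - (1ℚ +ℚ K) * b * a ^ k)
             +ℚ (1ℚ +ℚ K) * a ^ k * ((b - a) * (b - a))
  gap-step = solve 5 (λ a b K aᵏ bᵏ →
      (b :* (b :* bᵏ) :+ (con 1ℚ :+ K) :* (a :* (a :* aᵏ))) :- (con 1ℚ :+ (con 1ℚ :+ K)) :* b :* (a :* aᵏ)
      := b :* ((b :* bᵏ :+ K :* (a :* aᵏ)) :- (con 1ℚ :+ K) :* b :* aᵏ)
         :+ (con 1ℚ :+ K) :* aᵏ :* ((b :- a) :* (b :- a)))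
    refl a b K (a ^ k) (b ^ k)

-- The inductive step of AM–GM: if a list of k ≥ 1 nonnegative numbers with
-- sum s and product Π satisfies kᵏ·Π ≤ sᵏ, then adding α gives
-- (k+1)ᵏ⁺¹·α·Π ≤ (α+s)ᵏ⁺¹.  This is weighted-am-gm with a = (k+1)s and
-- b = k(α+s), after cancelling the positive factor k·kᵏ.
am-gm-step : ∀ j {α s Π} → let k = suc j in NonNeg α → NonNeg s →
             fromℕ k ^ k * Π ≤ s ^ k → fromℕ (suc k) ^ suc k * (α * Π) ≤ (α +ℚ s) ^ suc k
am-gm-step j {α} {s} {Π} 0≤α 0≤s kᵏΠ≤sᵏ = ℚₚ.*-cancelˡ-≤-pos (K * Kᵏ) {{positive KKᵏ>0}} (begin
  (K * Kᵏ) * (K₁ * Q * (α * Π))   ≡⟨ solve 6 (λ K Kᵏ K₁ Q α Π → (K :* Kᵏ) :* (K₁ :* Q :* (α :* Π))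
                                         := (K :* (K₁ :* (Q :* α))) :* (Kᵏ :* Π)) refl K Kᵏ K₁ Q α Π ⟩
  c * (Kᵏ * Π)                   ≤⟨ *-monoˡ c 0≤c kᵏΠ≤sᵏ ⟩
  c * sᵏ                         ≡⟨ solve 5 (λ K K₁ Q α sᵏ → (K :* (K₁ :* (Q :* α))) :* sᵏ
                                         := K :* (K₁ :* (Q :* (α :* sᵏ)))) refl K K₁ Q α sᵏ ⟩
  K * (K₁ * (Q * (α * sᵏ)))       ≤⟨ nonNeg-diff⇒≤ (subst NonNeg same-gap (≤⇒nonNeg-diff step)) ⟩
  (K * Kᵏ) * Z                   ∎)
  where
  open ℚₚ.≤-Reasoning
  k  = suc j
  K  = fromℕ k
  K₁ = fromℕ (suc k)
  Kᵏ = K ^ k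
  Q  = K₁ ^ k
  sᵏ = s ^ k
  Z  = (α +ℚ s) ^ suc k
  KKᵏ>0 : 0ℚ < K * Kᵏ
  KKᵏ>0 = *-pos (fromℕ-pos j) (^-pos k (fromℕ-pos j))
  a = K₁ * s
  b = K * (α +ℚ s)
  step : K₁ * b * (Q * sᵏ) ≤ (K * Kᵏ) * Z +ℚ K * (a * (Q * sᵏ))
  step = subst₂ _≤_ (cong (K₁ * b *_) (^-distrib-* K₁ s k))
           (cong₂ (λ x y → x +ℚ K * (a * y)) (^-distrib-* K (α +ℚ s) (suc k)) (^-distrib-* K₁ s k))
           (weighted-am-gm (*-nonNeg (fromℕ-nonNeg (suc k)) 0≤s)
                           (*-nonNeg (fromℕ-nonNeg k) (+-nonNeg 0≤α 0≤s)) k)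
  same-gap : ((K * Kᵏ) * Z +ℚ K * (a * (Q * sᵏ))) - K₁ * b * (Q * sᵏ)
           ≡ (K * Kᵏ) * Z - K * (K₁ * (Q * (α * sᵏ)))
  same-gap = solve 8 (λ K K₁ Kᵏ Z s Q sᵏ α →
      ((K :* Kᵏ) :* Z :+ K :* ((K₁ :* s) :* (Q :* sᵏ))) :- K₁ :* (K :* (α :+ s)) :* (Q :* sᵏ)
      := (K :* Kᵏ) :* Z :- K :* (K₁ :* (Q :* (α :* sᵏ))))
    refl K K₁ Kᵏ Z s Q sᵏ α
  c = K * (K₁ * (Q * α))
  0≤c : NonNeg c
  0≤c = *-nonNeg (fromℕ-nonNeg k) (*-nonNeg (fromℕ-nonNeg (suc k)) (*-nonNeg (^-nonNeg k (fromℕ-nonNeg (suc k))) 0≤α))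

am-gm : (αs : List ℚ) → All NonNeg αs → fromℕ (length αs) ^ length αs * prodℚ αs ≤ sumℚ αs ^ length αs
am-gm [] [] = ℚₚ.≤-refl
am-gm (α ∷ []) (_ ∷ []) = ℚₚ.≤-reflexive
  (solve 1 (λ α → (con 1ℚ :* con 1ℚ) :* (α :* con 1ℚ) := (α :+ con 0ℚ) :* con 1ℚ) refl α)
am-gm (α ∷ αs@(_ ∷ βs)) (0≤α ∷ 0≤αs) = am-gm-step (length βs) 0≤α (sumℚ-nonNeg 0≤αs) (am-gm αs 0≤αs)

bounded-by-zero : ∀ k {Z P} → NonNeg Z → Z ^ suc k ≤ P * 0ℚ ^ suc k → Z ≡ 0ℚ
bounded-by-zero k {Z} {P} 0≤Z Zᵐ≤0 = ℚₚ.≤-antisym (^-cancel-≤ k ℚₚ.≤-refl (subst (Z ^ suc k ≤_) P0≡0 Zᵐ≤0)) 0≤Z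
  where
  P0≡0 : P * 0ℚ ^ suc k ≡ 0ℚ ^ suc k
  P0≡0 = trans (cong (P *_) (0^suc k)) (trans (ℚₚ.*-zeroʳ P) (sym (0^suc k)))

-- If X ≤ p·A and Y ≤ p·B for the (possibly irrational) number p = P^{1/m},
-- then X + Y ≤ p·(A + B).  Root-free form, with m = k+1: otherwise
-- X(A+B) < A(X+Y) and Y(A+B) < B(X+Y), whose sum is absurd.
root-bound-+ : ∀ k {X Y A B P} → NonNeg X → NonNeg Y → NonNeg A → NonNeg B → NonNeg P →
               X ^ suc k ≤ P * A ^ suc k → Y ^ suc k ≤ P * B ^ suc k →
               (X +ℚ Y) ^ suc k ≤ P * (A +ℚ B) ^ suc k
root-bound-+ k {X} {Y} {A} {B} {P} 0≤X 0≤Y 0≤A 0≤B 0≤P Xᵐ≤ Yᵐ≤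
  with zero-or-pos 0≤A | zero-or-pos 0≤B
... | inj₁ refl | _ rewrite bounded-by-zero k {P = P} 0≤X Xᵐ≤ | ℚₚ.+-identityˡ Y | ℚₚ.+-identityˡ B = Yᵐ≤
... | inj₂ _ | inj₁ refl rewrite bounded-by-zero k {P = P} 0≤Y Yᵐ≤ | ℚₚ.+-identityʳ X | ℚₚ.+-identityʳ A = Xᵐ≤
... | inj₂ A>0 | inj₂ B>0 with (X +ℚ Y) ^ suc k ≤? P * (A +ℚ B) ^ suc k
...   | yes bound = bound
...   | no ¬bound = ⊥-elim (ℚₚ.<-irrefl cross-sum (ℚₚ.+-mono-< (cross {X} Xᵐ≤ A>0) (cross {Y} Yᵐ≤ B>0)))
  where
  open ℚₚ.≤-Reasoning
  S = A +ℚ B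
  T = X +ℚ Y
  Tᵐ>PSᵐ : P * S ^ suc k < T ^ suc k
  Tᵐ>PSᵐ = ℚₚ.≰⇒> ¬bound
  cross : ∀ {Z C} → Z ^ suc k ≤ P * C ^ suc k → 0ℚ < C → Z * S < C * T
  cross {Z} {C} Zᵐ≤ C>0 = ^-cancel-< k (*-nonNeg (ℚₚ.<⇒≤ C>0) (+-nonNeg 0≤X 0≤Y)) (begin-strict
    (Z * S) ^ suc k              ≡⟨ ^-distrib-* Z S (suc k) ⟩
    Z ^ suc k * S ^ suc k        ≤⟨ *-monoʳ (S ^ suc k) (^-nonNeg (suc k) (+-nonNeg 0≤A 0≤B)) Zᵐ≤ ⟩
    (P * C ^ suc k) * S ^ suc k  ≡⟨ solve 3 (λ P c s → (P :* c) :* s := c :* (P :* s)) refl P (C ^ suc k) (S ^ suc k) ⟩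
    C ^ suc k * (P * S ^ suc k)  <⟨ *-strictˡ (C ^ suc k) (^-pos (suc k) C>0) Tᵐ>PSᵐ ⟩
    C ^ suc k * T ^ suc k        ≡⟨ ^-distrib-* C T (suc k) ⟨
    (C * T) ^ suc k              ∎)
  cross-sum : X * S +ℚ Y * S ≡ A * T +ℚ B * T
  cross-sum = solve 4 (λ X Y A B → X :* (A :+ B) :+ Y :* (A :+ B) := A :* (X :+ Y) :+ B :* (X :+ Y)) refl X Y A B

Pairs : Set
Pairs = List (ℚ × ℚ)

Πˣ Πʸ Πˣ⁺ʸ : Pairs → ℚ
Πˣ   = prodℚ ∘ map proj₁
Πʸ   = prodℚ ∘ map proj₂
Πˣ⁺ʸ = prodℚ ∘ map (λ p → proj₁ p +ℚ proj₂ p)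

NonNegPair : ℚ × ℚ → Set
NonNegPair (x , y) = NonNeg x × NonNeg y

PosPair : ℚ × ℚ → Set
PosPair (x , y) = 0ℚ < x +ℚ y

Πˣ⁺ʸ-nonNeg : ∀ {ps} → All NonNegPair ps → NonNeg (Πˣ⁺ʸ ps)
Πˣ⁺ʸ-nonNeg []                 = 0≤1
Πˣ⁺ʸ-nonNeg ((0≤x , 0≤y) ∷ 0≤ps) = *-nonNeg (+-nonNeg 0≤x 0≤y) (Πˣ⁺ʸ-nonNeg 0≤ps)

degenerate-or-pos : ∀ ps → All NonNegPair ps →
                    (Πˣ ps ≡ 0ℚ × Πʸ ps ≡ 0ℚ × Πˣ⁺ʸ ps ≡ 0ℚ) ⊎ All PosPair ps
degenerate-or-pos [] [] = inj₂ []
degenerate-or-pos ((x , y) ∷ ps) ((0≤x , 0≤y) ∷ 0≤ps) with zero-or-pos (+-nonNeg 0≤x 0≤y)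
... | inj₁ x+y≡0 = inj₁ (head-zero x≡0 , head-zero y≡0 , head-zero x+y≡0)
  where
  head-zero : ∀ {z zs} → z ≡ 0ℚ → z * zs ≡ 0ℚ
  head-zero {zs = zs} refl = ℚₚ.*-zeroˡ zs
  x≡0 : x ≡ 0ℚ
  x≡0 = +-nonNeg-zero 0≤x 0≤y x+y≡0
  y≡0 : y ≡ 0ℚ
  y≡0 = +-nonNeg-zero 0≤y 0≤x (trans (ℚₚ.+-comm y x) x+y≡0)
... | inj₂ x+y>0 with degenerate-or-pos ps 0≤ps
...   | inj₁ (x₀ , y₀ , s₀) = inj₁ (tail-zero x x₀ , tail-zero y y₀ , tail-zero (x +ℚ y) s₀)
  where
  tail-zero : ∀ z {zs} → zs ≡ 0ℚ → z * zs ≡ 0ℚ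
  tail-zero z refl = ℚₚ.*-zeroʳ z
...   | inj₂ pos = inj₂ (x+y>0 ∷ pos)

-- Normalising each pair by its sum: shares aᵢ = xᵢ/(xᵢ+yᵢ), bᵢ = yᵢ/(xᵢ+yᵢ),
-- so that aᵢ + bᵢ = 1, Π xᵢ = Π (xᵢ+yᵢ) · Π aᵢ and Π yᵢ = Π (xᵢ+yᵢ) · Π bᵢ.
record Shares (ps : Pairs) : Set where
  field
    as bs   : List ℚ
    length-as : length as ≡ length ps
    length-bs : length bs ≡ length ps
    0≤as    : All NonNeg as
    0≤bs    : All NonNeg bs
    total   : sumℚ as +ℚ sumℚ bs ≡ fromℕ (length ps)
    Πˣ≡     : Πˣ ps ≡ Πˣ⁺ʸ ps * prodℚ as
    Πʸ≡     : Πʸ ps ≡ Πˣ⁺ʸ ps * prodℚ bs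

inverse : ∀ s → 0ℚ < s → Σ ℚ (λ i → NonNeg i × s * i ≡ 1ℚ)
inverse s s>0 = (1/ s) {{s≢0}} , ℚₚ.<⇒≤ (ℚₚ.positive⁻¹ _ {{ℚₚ.1/pos⇒pos s {{positive s>0}}}}) , ℚₚ.*-inverseʳ s {{s≢0}}
  where
  s≢0 : NonZero s
  s≢0 = ℚₚ.pos⇒nonZero s {{positive s>0}}

shares : ∀ ps → All NonNegPair ps → All PosPair ps → Shares ps
shares [] [] [] = record
  { as = [] ; bs = [] ; length-as = refl ; length-bs = refl ; 0≤as = [] ; 0≤bs = []
  ; total = ℚₚ.+-identityʳ 0ℚ ; Πˣ≡ = sym (ℚₚ.*-identityʳ 1ℚ) ; Πʸ≡ = sym (ℚₚ.*-identityʳ 1ℚ) }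
shares ((x , y) ∷ ps) ((0≤x , 0≤y) ∷ 0≤ps) (x+y>0 ∷ pos) = record
  { as = x * i ∷ S.as ; bs = y * i ∷ S.bs
  ; length-as = cong suc S.length-as ; length-bs = cong suc S.length-bs
  ; 0≤as = *-nonNeg 0≤x 0≤i ∷ S.0≤as ; 0≤bs = *-nonNeg 0≤y 0≤i ∷ S.0≤bs
  ; total = begin
      (x * i +ℚ sumℚ S.as) +ℚ (y * i +ℚ sumℚ S.bs)
        ≡⟨ solve 5 (λ x y i a b → (x :* i :+ a) :+ (y :* i :+ b) := (x :+ y) :* i :+ (a :+ b)) refl x y i (sumℚ S.as) (sumℚ S.bs) ⟩
      (x +ℚ y) * i +ℚ (sumℚ S.as +ℚ sumℚ S.bs)  ≡⟨ cong₂ _+ℚ_ [x+y]i≡1 S.total ⟩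
      1ℚ +ℚ fromℕ (length ps)                    ≡⟨ fromℕ-suc (length ps) ⟨
      fromℕ (suc (length ps))                    ∎
  ; Πˣ≡ = scaled x S.as S.Πˣ≡
  ; Πʸ≡ = scaled y S.bs S.Πʸ≡ }
  where
  open ≡-Reasoning
  module S = Shares (shares ps 0≤ps pos)
  i = proj₁ (inverse (x +ℚ y) x+y>0)
  0≤i = proj₁ (proj₂ (inverse (x +ℚ y) x+y>0))
  [x+y]i≡1 = proj₂ (proj₂ (inverse (x +ℚ y) x+y>0))
  scaled : ∀ z zs {Πz} → Πz ≡ Πˣ⁺ʸ ps * prodℚ zs → z * Πz ≡ ((x +ℚ y) * Πˣ⁺ʸ ps) * (z * i * prodℚ zs)
  scaled z zs refl = begin
    z * (Πˣ⁺ʸ ps * prodℚ zs)                          ≡⟨ ℚₚ.*-identityʳ _ ⟨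
    z * (Πˣ⁺ʸ ps * prodℚ zs) * 1ℚ                     ≡⟨ cong (z * (Πˣ⁺ʸ ps * prodℚ zs) *_) [x+y]i≡1 ⟨
    z * (Πˣ⁺ʸ ps * prodℚ zs) * ((x +ℚ y) * i)         ≡⟨ solve 6 (λ z P Z s i t → z :* (P :* Z) :* (s :* i) := (s :* P) :* (z :* i :* Z))
                                                          refl z (Πˣ⁺ʸ ps) (prodℚ zs) (x +ℚ y) i 0ℚ ⟩
    ((x +ℚ y) * Πˣ⁺ʸ ps) * (z * i * prodℚ zs)         ∎

-- Hölder's inequality for two terms in root-free form: for m = k+1 pairs
-- of nonnegative numbers, Xᵐ ≤ C·Π xᵢ and Yᵐ ≤ C·Π yᵢ imply
-- (X+Y)ᵐ ≤ C·Π (xᵢ+yᵢ).  When all pairs have positive sums, normalise them: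
-- AM–GM gives (mX)ᵐ ≤ P·(Σ aᵢ)ᵐ and (mY)ᵐ ≤ P·(Σ bᵢ)ᵐ with P = C·Π(xᵢ+yᵢ),
-- and root-bound-+ combines them using Σ aᵢ + Σ bᵢ = m.
holder₂-pos : ∀ k ps → length ps ≡ suc k → All NonNegPair ps → All PosPair ps → ∀ {C X Y} →
              NonNeg C → NonNeg X → NonNeg Y →
              X ^ suc k ≤ C * Πˣ ps → Y ^ suc k ≤ C * Πʸ ps → (X +ℚ Y) ^ suc k ≤ C * Πˣ⁺ʸ ps
holder₂-pos k ps len 0≤ps pos {C} {X} {Y} 0≤C 0≤X 0≤Y Xᵐ≤ Yᵐ≤ =
  ℚₚ.*-cancelˡ-≤-pos (M ^ m) {{positive (^-pos m M>0)}} (begin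
    M ^ m * (X +ℚ Y) ^ m              ≡⟨ ^-distrib-* M (X +ℚ Y) m ⟨
    (M * (X +ℚ Y)) ^ m                ≡⟨ cong (_^ m) (ℚₚ.*-distribˡ-+ M X Y) ⟩
    (M * X +ℚ M * Y) ^ m              ≤⟨ root-bound-+ k (*-nonNeg 0≤M 0≤X) (*-nonNeg 0≤M 0≤Y)
                                            (sumℚ-nonNeg S.0≤as) (sumℚ-nonNeg S.0≤bs) 0≤P
                                            (scale (subst (λ z → X ^ m ≤ C * z) S.Πˣ≡ Xᵐ≤) (am-gm′ S.as S.0≤as S.length-as))
                                            (scale (subst (λ z → Y ^ m ≤ C * z) S.Πʸ≡ Yᵐ≤) (am-gm′ S.bs S.0≤bs S.length-bs)) ⟩
    P * (sumℚ S.as +ℚ sumℚ S.bs) ^ m  ≡⟨ cong (λ z → P * z ^ m) (trans S.total (cong fromℕ len)) ⟩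
    P * M ^ m                         ≡⟨ ℚₚ.*-comm P (M ^ m) ⟩
    M ^ m * P                         ∎)
  where
  open ℚₚ.≤-Reasoning
  module S = Shares (shares ps 0≤ps pos)
  m = suc k
  M = fromℕ m
  M>0 : 0ℚ < M
  M>0 = fromℕ-pos k
  0≤M : NonNeg M
  0≤M = ℚₚ.<⇒≤ M>0
  P = C * Πˣ⁺ʸ ps
  0≤P : NonNeg P
  0≤P = *-nonNeg 0≤C (Πˣ⁺ʸ-nonNeg 0≤ps)
  am-gm′ : ∀ zs → All NonNeg zs → length zs ≡ length ps → M ^ m * prodℚ zs ≤ sumℚ zs ^ m
  am-gm′ zs 0≤zs len-zs = subst (λ l → fromℕ l ^ l * prodℚ zs ≤ sumℚ zs ^ l) (trans len-zs len) (am-gm zs 0≤zs)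
  scale : ∀ {Z Π S} → Z ^ m ≤ C * (Πˣ⁺ʸ ps * Π) → M ^ m * Π ≤ S → (M * Z) ^ m ≤ P * S
  scale {Z} {Π} {S} Zᵐ≤ am-gm-Π = begin
    (M * Z) ^ m                  ≡⟨ ^-distrib-* M Z m ⟩
    M ^ m * Z ^ m                ≤⟨ *-monoˡ (M ^ m) (^-nonNeg m 0≤M) Zᵐ≤ ⟩
    M ^ m * (C * (Πˣ⁺ʸ ps * Π))  ≡⟨ solve 4 (λ a c p q → a :* (c :* (p :* q)) := (c :* p) :* (a :* q)) refl (M ^ m) C (Πˣ⁺ʸ ps) Π ⟩
    P * (M ^ m * Π)              ≤⟨ *-monoˡ P 0≤P am-gm-Π ⟩
    P * S                        ∎

-- In the degenerate case all three products vanish, and then so do X and Y.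
holder₂ : ∀ k ps → length ps ≡ suc k → All NonNegPair ps → ∀ {C X Y} → NonNeg C → NonNeg X → NonNeg Y →
          X ^ suc k ≤ C * Πˣ ps → Y ^ suc k ≤ C * Πʸ ps → (X +ℚ Y) ^ suc k ≤ C * Πˣ⁺ʸ ps
holder₂ k ps len 0≤ps {C} {X} {Y} 0≤C 0≤X 0≤Y Xᵐ≤ Yᵐ≤ with degenerate-or-pos ps 0≤ps
... | inj₂ pos = holder₂-pos k ps len 0≤ps pos 0≤C 0≤X 0≤Y Xᵐ≤ Yᵐ≤
... | inj₁ (Πˣ≡0 , Πʸ≡0 , Πˣ⁺ʸ≡0) = ℚₚ.≤-reflexive (begin
  (X +ℚ Y) ^ suc k   ≡⟨ cong₂ (λ x y → (x +ℚ y) ^ suc k) (vanishes 0≤X Πˣ≡0 Xᵐ≤) (vanishes 0≤Y Πʸ≡0 Yᵐ≤) ⟩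
  (0ℚ +ℚ 0ℚ) ^ suc k ≡⟨ 0^suc k ⟩
  0ℚ                 ≡⟨ ℚₚ.*-zeroʳ C ⟨
  C * 0ℚ             ≡⟨ cong (C *_) Πˣ⁺ʸ≡0 ⟨
  C * Πˣ⁺ʸ ps        ∎)
  where
  open ≡-Reasoning
  vanishes : ∀ {Z Π} → NonNeg Z → Π ≡ 0ℚ → Z ^ suc k ≤ C * Π → Z ≡ 0ℚ
  vanishes {Z} 0≤Z refl Zᵐ≤ = bounded-by-zero k {P = C} 0≤Z (subst (λ z → Z ^ suc k ≤ C * z) (sym (0^suc k)) Zᵐ≤)

-- Boolean folds over the vertex set Fin n, as folds of functional vectors.
-- Unlike anyV/allV/countV of Defs they unfold definitionally:
-- anyᶠ p ≡ p 0 ∨ anyᶠ (p ∘ suc), and so on.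

anyᶠ allᶠ : ∀ {n} → (Fin n → Bool) → Bool
anyᶠ = VF.foldr _∨_ false
allᶠ = VF.foldr _∧_ true

countStep : Bool → ℕ → ℕ
countStep b m = if b then suc m else m

countᶠ : ∀ {n} → (Fin n → Bool) → ℕ
countᶠ = VF.foldr countStep 0

foldr-tabulate : ∀ {n} {X A B : Set} (g : A → B → B) (f : X → A) (t : Fin n → X) e →
                 List.foldr (λ x → g (f x)) e (List.tabulate t) ≡ VF.foldr g e (f ∘ t)
foldr-tabulate {zero}  g f t e = refl
foldr-tabulate {suc n} g f t e = cong (g (f (t fzero))) (foldr-tabulate g f (t ∘ fsuc) e)

anyV≡anyᶠ : ∀ {n} (p : Fin n → Bool) → anyV p ≡ anyᶠ p
anyV≡anyᶠ p = foldr-tabulate _∨_ p (λ i → i) false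

allV≡allᶠ : ∀ {n} (p : Fin n → Bool) → allV p ≡ allᶠ p
allV≡allᶠ p = foldr-tabulate _∧_ p (λ i → i) true

length-filter : ∀ {X : Set} (p : X → Bool) xs →
                length (List.filter (λ x → p x 𝔹.≟ true) xs) ≡ List.foldr (λ x → countStep (p x)) 0 xs
length-filter p []       = refl
length-filter p (x ∷ xs) with p x
... | true  = cong suc (length-filter p xs)
... | false = length-filter p xs

countV≡countᶠ : ∀ {n} (p : Fin n → Bool) → countV p ≡ countᶠ p
countV≡countᶠ {n} p = trans (length-filter p (allFin n)) (foldr-tabulate countStep p (λ i → i) 0)

foldᶠ-cong : ∀ {n} {B : Set} (g : Bool → B → B) e {p q : Fin n → Bool} → (∀ i → p i ≡ q i) →
             VF.foldr g e p ≡ VF.foldr g e q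
foldᶠ-cong {zero}  g e p≗q = refl
foldᶠ-cong {suc n} g e p≗q = cong₂ g (p≗q fzero) (foldᶠ-cong g e (p≗q ∘ fsuc))

allᶠ-const : ∀ n b → allᶠ {suc n} (λ _ → b) ≡ b
allᶠ-const zero    b = 𝔹.∧-identityʳ b
allᶠ-const (suc n) b = trans (cong (b ∧_) (allᶠ-const n b)) (𝔹.∧-idem b)

countᶠ-const : ∀ n b → countᶠ {n} (λ _ → b) ≡ (if b then n else 0)
countᶠ-const zero    true  = refl
countᶠ-const zero    false = refl
countᶠ-const (suc n) true  = cong suc (countᶠ-const n true)
countᶠ-const (suc n) false = countᶠ-const n false

-- A constraint (f , A) on n boolean variables, with
-- support A ⊆ Fin n, is satisfied by S ⊆ Fin n when f holds or S meets A.
-- Fixing the first variable in or out of S leaves a constraint on the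
-- remaining variables.

Constraint : ℕ → Set
Constraint n = Bool × Vec Bool n

meets : ∀ {n} → Vec Bool n → Vec Bool n → Bool
meets S A = anyᶠ (λ i → lookup S i ∧ lookup A i)

card : ∀ {n} → Vec Bool n → ℕ
card S = countᶠ (lookup S)

satisfies : ∀ {n} → Vec Bool n → Constraint n → Bool
satisfies S (f , A) = f ∨ meets S A

satisfiesAll : ∀ {n} → Vec Bool n → List (Constraint n) → Bool
satisfiesAll S []      = true
satisfiesAll S (c ∷ L) = satisfies S c ∧ satisfiesAll S L

multiplicity : ∀ {n} → Fin n → List (Constraint n) → ℕ
multiplicity i []            = 0
multiplicity i ((_ , A) ∷ L) = countStep (lookup A i) (multiplicity i L)

fixIn fixOut : ∀ {n} → Constraint (suc n) → Constraint n
fixIn  (f , a ∷ A) = (f ∨ a , A)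
fixOut (f , a ∷ A) = (f , A)

satisfiesAll-in : ∀ {n} (S : Vec Bool n) L → satisfiesAll (true ∷ S) L ≡ satisfiesAll S (map fixIn L)
satisfiesAll-in S []                  = refl
satisfiesAll-in S ((f , a ∷ A) ∷ L) = cong₂ _∧_ (sym (𝔹.∨-assoc f a (meets S A))) (satisfiesAll-in S L)

satisfiesAll-out : ∀ {n} (S : Vec Bool n) L → satisfiesAll (false ∷ S) L ≡ satisfiesAll S (map fixOut L)
satisfiesAll-out S []                  = refl
satisfiesAll-out S ((f , a ∷ A) ∷ L) = cong (satisfies S (f , A) ∧_) (satisfiesAll-out S L)

multiplicity-fixIn : ∀ {n} (i : Fin n) L → multiplicity i (map fixIn L) ≡ multiplicity (fsuc i) L
multiplicity-fixIn i []                  = refl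
multiplicity-fixIn i ((f , a ∷ A) ∷ L) = cong (countStep (lookup A i)) (multiplicity-fixIn i L)

multiplicity-fixOut : ∀ {n} (i : Fin n) L → multiplicity i (map fixOut L) ≡ multiplicity (fsuc i) L
multiplicity-fixOut i []                  = refl
multiplicity-fixOut i ((f , a ∷ A) ∷ L) = cong (countStep (lookup A i)) (multiplicity-fixOut i L)

-- A single constraint (f , A) with |A| = a has local weight
-- (1+μ)ᵃ if f holds and (1+μ)ᵃ - 1 otherwise (all S ⊆ A, resp. S ≠ ∅).
module WeightedCount (μ : ℚ) (0≤μ : NonNeg μ) where

  weight : ∀ {n} → List (Constraint n) → Vec Bool n → ℚ
  weight L S = if satisfiesAll S L then μ ^ card S else 0ℚ

  Z : ∀ n → List (Constraint n) → ℚ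
  Z n L = sumℚ (map (weight L) (allSubsets n))

  u : ℚ
  u = 1ℚ +ℚ μ

  w : ∀ {n} → Constraint n → ℚ
  w (f , A) = if f then u ^ card A else u ^ card A - 1ℚ

  wΠ : ∀ {n} → List (Constraint n) → ℚ
  wΠ L = prodℚ (map w L)

  1≤u^ : ∀ m → 1ℚ ≤ u ^ m
  1≤u^ zero    = ℚₚ.≤-refl
  1≤u^ (suc m) = subst (_≤ u * u ^ m) (ℚₚ.*-identityˡ 1ℚ)
    (*-mono (+-nonNeg 0≤1 0≤μ) 0≤1 (subst (_≤ u) (ℚₚ.+-identityʳ 1ℚ) (ℚₚ.+-monoʳ-≤ 1ℚ 0≤μ)) (1≤u^ m))

  w-nonNeg : ∀ {n} (c : Constraint n) → NonNeg (w c)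
  w-nonNeg (true  , A) = ℚₚ.≤-trans 0≤1 (1≤u^ (card A))
  w-nonNeg (false , A) = ≤⇒nonNeg-diff (1≤u^ (card A))

  Z-nonNeg : ∀ n L → NonNeg (Z n L)
  Z-nonNeg n L = go (allSubsets n)
    where
    weight-nonNeg : ∀ S → NonNeg (weight L S)
    weight-nonNeg S with satisfiesAll S L
    ... | true  = ^-nonNeg (card S) 0≤μ
    ... | false = ℚₚ.≤-refl
    go : ∀ Ss → NonNeg (sumℚ (map (weight L) Ss))
    go []       = ℚₚ.≤-refl
    go (S ∷ Ss) = +-nonNeg (weight-nonNeg S) (go Ss)

  Z-step : ∀ n L → Z (suc n) L ≡ μ * Z n (map fixIn L) +ℚ Z n (map fixOut L)
  Z-step n L = begin
    sumℚ (map (weight L) (map (true ∷_) Ss List.++ map (false ∷_) Ss))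
      ≡⟨ cong sumℚ (Listₚ.map-++ (weight L) (map (true ∷_) Ss) (map (false ∷_) Ss)) ⟩
    sumℚ (map (weight L) (map (true ∷_) Ss) List.++ map (weight L) (map (false ∷_) Ss))
      ≡⟨ sumℚ-++ (map (weight L) (map (true ∷_) Ss)) _ ⟩
    sumℚ (map (weight L) (map (true ∷_) Ss)) +ℚ sumℚ (map (weight L) (map (false ∷_) Ss))
      ≡⟨ cong₂ _+ℚ_ (cong sumℚ (Listₚ.map-∘ Ss)) (cong sumℚ (Listₚ.map-∘ Ss)) ⟨
    sumℚ (map (weight L ∘ (true ∷_)) Ss) +ℚ sumℚ (map (weight L ∘ (false ∷_)) Ss)
      ≡⟨ cong₂ _+ℚ_ (trans (sumℚ-cong weight-in Ss) (sumℚ-scale μ (weight (map fixIn L)) Ss))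
                    (sumℚ-cong weight-out Ss) ⟩
    μ * Z n (map fixIn L) +ℚ Z n (map fixOut L) ∎
    where
    open ≡-Reasoning
    Ss = allSubsets n
    weight-in : ∀ S → weight L (true ∷ S) ≡ μ * weight (map fixIn L) S
    weight-in S rewrite satisfiesAll-in S L with satisfiesAll S (map fixIn L)
    ... | true  = refl
    ... | false = sym (ℚₚ.*-zeroʳ μ)
    weight-out : ∀ S → weight L (false ∷ S) ≡ weight (map fixOut L) S
    weight-out S rewrite satisfiesAll-out S L = refl

  indicator : Bool → ℚ
  indicator b = if b then 1ℚ else 0ℚ

  Z-base : ∀ L → Z 0 L ≡ indicator (satisfiesAll [] L)
  Z-base L with satisfiesAll [] L
  ... | true  = refl
  ... | false = refl

  wΠ-base : ∀ L → wΠ L ≡ indicator (satisfiesAll [] L)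
  wΠ-base []                = refl
  wΠ-base ((true  , []) ∷ L) = trans (ℚₚ.*-identityˡ (wΠ L)) (wΠ-base L)
  wΠ-base ((false , []) ∷ L) = solve 1 (λ x → (con 1ℚ :- con 1ℚ) :* x := con 0ℚ) refl (wΠ L)

  -- Relative to the first variable, a constraint c containing it contributes
  -- the pair (μ·w(fixIn c) , w(fixOut c)); the others contribute the factor
  -- w(c) = w(fixIn c) = w(fixOut c) to a common coefficient.
  firstPairs : ∀ {n} → List (Constraint (suc n)) → Pairs
  firstPairs []                    = []
  firstPairs ((f , true  ∷ A) ∷ L) = (μ * w (f ∨ true , A) , w (f , A)) ∷ firstPairs L
  firstPairs ((f , false ∷ A) ∷ L) = firstPairs L

  otherFactor : ∀ {n} → List (Constraint (suc n)) → ℚ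
  otherFactor []                    = 1ℚ
  otherFactor ((f , true  ∷ A) ∷ L) = otherFactor L
  otherFactor ((f , false ∷ A) ∷ L) = w (f , A) * otherFactor L

  length-firstPairs : ∀ {n} (L : List (Constraint (suc n))) → length (firstPairs L) ≡ multiplicity fzero L
  length-firstPairs []                    = refl
  length-firstPairs ((f , true  ∷ A) ∷ L) = cong suc (length-firstPairs L)
  length-firstPairs ((f , false ∷ A) ∷ L) = length-firstPairs L

  firstPairs-nonNeg : ∀ {n} (L : List (Constraint (suc n))) → All NonNegPair (firstPairs L)
  firstPairs-nonNeg []                    = []
  firstPairs-nonNeg ((f , true  ∷ A) ∷ L) = (*-nonNeg 0≤μ (w-nonNeg (f ∨ true , A)) , w-nonNeg (f , A)) ∷ firstPairs-nonNeg L
  firstPairs-nonNeg ((f , false ∷ A) ∷ L) = firstPairs-nonNeg L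

  otherFactor-nonNeg : ∀ {n} (L : List (Constraint (suc n))) → NonNeg (otherFactor L)
  otherFactor-nonNeg []                    = 0≤1
  otherFactor-nonNeg ((f , true  ∷ A) ∷ L) = otherFactor-nonNeg L
  otherFactor-nonNeg ((f , false ∷ A) ∷ L) = *-nonNeg (w-nonNeg (f , A)) (otherFactor-nonNeg L)

  w-split : ∀ {n} f (A : Vec Bool n) → w (f , true ∷ A) ≡ μ * w (f ∨ true , A) +ℚ w (f , A)
  w-split true  A = solve 2 (λ m x → (con 1ℚ :+ m) :* x := m :* x :+ x) refl μ (u ^ card A)
  w-split false A = solve 2 (λ m x → (con 1ℚ :+ m) :* x :- con 1ℚ := m :* x :+ (x :- con 1ℚ)) refl μ (u ^ card A)

  private
    swap-front : ∀ a b c → a * (b * c) ≡ b * (a * c)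
    swap-front a b c = solve 3 (λ a b c → a :* (b :* c) := b :* (a :* c)) refl a b c

  wΠ-fixIn : ∀ {n} (L : List (Constraint (suc n))) →
             μ ^ multiplicity fzero L * wΠ (map fixIn L) ≡ otherFactor L * Πˣ (firstPairs L)
  wΠ-fixIn [] = ℚₚ.*-identityˡ 1ℚ
  wΠ-fixIn ((f , true ∷ A) ∷ L) = begin
    μ * μ ^ m * (w′ * wΠ (map fixIn L))    ≡⟨ solve 4 (λ a b c d → a :* b :* (c :* d) := (a :* c) :* (b :* d)) refl μ (μ ^ m) w′ (wΠ (map fixIn L)) ⟩
    (μ * w′) * (μ ^ m * wΠ (map fixIn L))  ≡⟨ cong ((μ * w′) *_) (wΠ-fixIn L) ⟩
    (μ * w′) * (otherFactor L * Πˣ (firstPairs L)) ≡⟨ swap-front (μ * w′) (otherFactor L) _ ⟩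
    otherFactor L * ((μ * w′) * Πˣ (firstPairs L)) ∎
    where
    open ≡-Reasoning
    m = multiplicity fzero L
    w′ = w (f ∨ true , A)
  wΠ-fixIn ((f , false ∷ A) ∷ L) = begin
    μ ^ m * (w (f ∨ false , A) * wΠ (map fixIn L)) ≡⟨ cong (λ g → μ ^ m * (w (g , A) * wΠ (map fixIn L))) (𝔹.∨-identityʳ f) ⟩
    μ ^ m * (w (f , A) * wΠ (map fixIn L))         ≡⟨ swap-front (μ ^ m) (w (f , A)) _ ⟩
    w (f , A) * (μ ^ m * wΠ (map fixIn L))         ≡⟨ cong (w (f , A) *_) (wΠ-fixIn L) ⟩
    w (f , A) * (otherFactor L * Πˣ (firstPairs L)) ≡⟨ ℚₚ.*-assoc (w (f , A)) (otherFactor L) _ ⟨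
    w (f , A) * otherFactor L * Πˣ (firstPairs L)   ∎
    where
    open ≡-Reasoning
    m = multiplicity fzero L

  wΠ-fixOut : ∀ {n} (L : List (Constraint (suc n))) → wΠ (map fixOut L) ≡ otherFactor L * Πʸ (firstPairs L)
  wΠ-fixOut []                    = sym (ℚₚ.*-identityˡ 1ℚ)
  wΠ-fixOut ((f , true  ∷ A) ∷ L) rewrite wΠ-fixOut L = swap-front (w (f , A)) (otherFactor L) _
  wΠ-fixOut ((f , false ∷ A) ∷ L) rewrite wΠ-fixOut L = sym (ℚₚ.*-assoc (w (f , A)) (otherFactor L) _)

  wΠ-split : ∀ {n} (L : List (Constraint (suc n))) → wΠ L ≡ otherFactor L * Πˣ⁺ʸ (firstPairs L)
  wΠ-split []                    = sym (ℚₚ.*-identityˡ 1ℚ)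
  wΠ-split ((f , true  ∷ A) ∷ L) rewrite wΠ-split L | w-split f A = swap-front (μ * w (f ∨ true , A) +ℚ w (f , A)) (otherFactor L) _
  wΠ-split ((f , false ∷ A) ∷ L) rewrite wΠ-split L = sym (ℚₚ.*-assoc (w (f , A)) (otherFactor L) _)

  -- By induction on the number of variables:
  -- fixing the first variable in or out of S gives two systems in which every
  -- remaining variable still has multiplicity k+1, and holder₂ recombines
  -- the two bounds along the k+1 constraints containing the first variable.
  Z-bound : ∀ n k L → (∀ i → multiplicity i L ≡ suc k) → Z n L ^ suc k ≤ wΠ L
  Z-bound zero k L _ rewrite Z-base L | wΠ-base L with satisfiesAll [] L
  ... | true  = ℚₚ.≤-reflexive (1^ (suc k))
  ... | false = ℚₚ.≤-reflexive (0^suc k)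
  Z-bound (suc n) k L mult rewrite Z-step n L | wΠ-split L =
    holder₂ k (firstPairs L) (trans (length-firstPairs L) (mult fzero)) (firstPairs-nonNeg L)
      (otherFactor-nonNeg L) (*-nonNeg 0≤μ (Z-nonNeg n Lᵢₙ)) (Z-nonNeg n Lₒᵤₜ) in-bound out-bound
    where
    open ℚₚ.≤-Reasoning
    Lᵢₙ = map fixIn L
    Lₒᵤₜ = map fixOut L
    in-bound : (μ * Z n Lᵢₙ) ^ suc k ≤ otherFactor L * Πˣ (firstPairs L)
    in-bound = begin
      (μ * Z n Lᵢₙ) ^ suc k             ≡⟨ ^-distrib-* μ (Z n Lᵢₙ) (suc k) ⟩
      μ ^ suc k * Z n Lᵢₙ ^ suc k       ≤⟨ *-monoˡ (μ ^ suc k) (^-nonNeg (suc k) 0≤μ)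
                                             (Z-bound n k Lᵢₙ (λ i → trans (multiplicity-fixIn i L) (mult (fsuc i)))) ⟩
      μ ^ suc k * wΠ Lᵢₙ                ≡⟨ cong (λ m → μ ^ m * wΠ Lᵢₙ) (mult fzero) ⟨
      μ ^ multiplicity fzero L * wΠ Lᵢₙ ≡⟨ wΠ-fixIn L ⟩
      otherFactor L * Πˣ (firstPairs L) ∎
    out-bound : Z n Lₒᵤₜ ^ suc k ≤ otherFactor L * Πʸ (firstPairs L)
    out-bound = subst (Z n Lₒᵤₜ ^ suc k ≤_) (wΠ-fixOut L)
                  (Z-bound n k Lₒᵤₜ (λ i → trans (multiplicity-fixOut i L) (mult (fsuc i))))

  -- The equality case: if every variable lies in exactly one constraint, the
  -- constraints are independent and Z(L) = Π_c w(c).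
  Z-exact : ∀ n L → (∀ i → multiplicity i L ≡ 1) → Z n L ≡ wΠ L
  Z-exact zero L _ = trans (Z-base L) (sym (wΠ-base L))
  Z-exact (suc n) L mult = begin
    Z (suc n) L                                ≡⟨ Z-step n L ⟩
    μ * Z n Lᵢₙ +ℚ Z n Lₒᵤₜ                    ≡⟨ cong₂ (λ x y → μ * x +ℚ y)
                                                   (Z-exact n Lᵢₙ (λ i → trans (multiplicity-fixIn i L) (mult (fsuc i))))
                                                   (Z-exact n Lₒᵤₜ (λ i → trans (multiplicity-fixOut i L) (mult (fsuc i)))) ⟩
    μ * wΠ Lᵢₙ +ℚ wΠ Lₒᵤₜ                      ≡⟨ cong₂ _+ℚ_ μwΠ≡ (wΠ-fixOut L) ⟩
    C * Πˣ (firstPairs L) +ℚ C * Πʸ (firstPairs L) ≡⟨ single-pair (firstPairs L) (trans (length-firstPairs L) (mult fzero)) ⟩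
    C * Πˣ⁺ʸ (firstPairs L)                    ≡⟨ wΠ-split L ⟨
    wΠ L                                       ∎
    where
    open ≡-Reasoning
    Lᵢₙ = map fixIn L
    Lₒᵤₜ = map fixOut L
    C = otherFactor L
    μwΠ≡ : μ * wΠ Lᵢₙ ≡ C * Πˣ (firstPairs L)
    μwΠ≡ = trans (cong (_* wΠ Lᵢₙ) (sym (ℚₚ.*-identityʳ μ)))
                 (trans (cong (λ m → μ ^ m * wΠ Lᵢₙ) (sym (mult fzero))) (wΠ-fixIn L))
    single-pair : ∀ ps → length ps ≡ 1 → C * Πˣ ps +ℚ C * Πʸ ps ≡ C * Πˣ⁺ʸ ps
    single-pair ((x , y) ∷ []) refl =
      solve 3 (λ C x y → C :* (x :* con 1ℚ) :+ C :* (y :* con 1ℚ) := C :* ((x :+ y) :* con 1ℚ)) refl C x y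

-- For a property P of
-- subsets, Σₖ #{S : P S, |S| = k}·μᵏ = Σ_{S : P S} μ^|S|: expand each
-- coefficient as a sum over subsets, exchange the two sums, and observe that
-- for each S exactly one k ≤ n equals |S|.

module _ (m : ℕ) (g : ℕ → ℚ) where

  pick : ℕ → ℚ
  pick k = if ⌊ m ℕ.≟ k ⌋ then g k else 0ℚ

  pick-other : ∀ {k} → m ≢ k → pick k ≡ 0ℚ
  pick-other {k} m≢k with m ℕ.≟ k
  ... | yes m≡k = ⊥-elim (m≢k m≡k)
  ... | no  _   = refl

  pick-self : pick m ≡ g m
  pick-self with m ℕ.≟ m
  ... | yes _   = refl
  ... | no  m≢m = ⊥-elim (m≢m refl)

  sum-pick-absent : ∀ N → N ℕ.≤ m → sumℚ (map pick (upTo N)) ≡ 0ℚ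
  sum-pick-absent zero    _   = refl
  sum-pick-absent (suc N) N<m = begin
    sumℚ (map pick (upTo (suc N)))        ≡⟨ sumℚ-upTo-suc pick N ⟩
    sumℚ (map pick (upTo N)) +ℚ pick N    ≡⟨ cong₂ _+ℚ_ (sum-pick-absent N (ℕₚ.<⇒≤ N<m)) (pick-other (ℕₚ.<⇒≢ N<m ∘ sym)) ⟩
    0ℚ +ℚ 0ℚ                              ≡⟨ ℚₚ.+-identityʳ 0ℚ ⟩
    0ℚ                                    ∎
    where open ≡-Reasoning

  sum-pick-present : ∀ N → m ℕ.< N → sumℚ (map pick (upTo N)) ≡ g m
  sum-pick-present (suc N) m<1+N = begin
    sumℚ (map pick (upTo (suc N)))        ≡⟨ sumℚ-upTo-suc pick N ⟩
    sumℚ (map pick (upTo N)) +ℚ pick N    ≡⟨ last-or-earlier (ℕₚ.m<1+n⇒m<n∨m≡n m<1+N) ⟩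
    g m                                   ∎
    where
    open ≡-Reasoning
    last-or-earlier : m ℕ.< N ⊎ m ≡ N → sumℚ (map pick (upTo N)) +ℚ pick N ≡ g m
    last-or-earlier (inj₁ m<N) = trans (cong₂ _+ℚ_ (sum-pick-present N m<N) (pick-other (ℕₚ.<⇒≢ m<N)))
                                       (ℚₚ.+-identityʳ (g m))
    last-or-earlier (inj₂ refl) = trans (cong₂ _+ℚ_ (sum-pick-absent N ℕₚ.≤-refl) pick-self) (ℚₚ.+-identityˡ (g m))

size≡card : ∀ {n} (S : Vec Bool n) → size S ≡ card S
size≡card S = countV≡countᶠ (lookup S)

card≤ : ∀ {n} (S : Vec Bool n) → card S ℕ.≤ n
card≤ []          = z≤n
card≤ (true  ∷ S) = s≤s (card≤ S)
card≤ (false ∷ S) = ℕₚ.m≤n⇒m≤1+n (card≤ S)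

fromℕ-count : ∀ {A : Set} (q : A → Bool) xs →
              fromℕ (List.foldr (λ x → countStep (q x)) 0 xs) ≡ sumℚ (map (λ x → if q x then 1ℚ else 0ℚ) xs)
fromℕ-count q []       = refl
fromℕ-count q (x ∷ xs) with q x
... | true  = trans (fromℕ-suc (List.foldr (λ x → countStep (q x)) 0 xs)) (cong (1ℚ +ℚ_) (fromℕ-count q xs))
... | false = trans (fromℕ-count q xs) (sym (ℚₚ.+-identityˡ _))

evalPoly-countSets : ∀ n (P : Subset n → Bool) μ →
  evalPoly n (countSets P) μ ≡ sumℚ (map (λ S → if P S then μ ^ card S else 0ℚ) (allSubsets n))
evalPoly-countSets n P μ = begin
  evalPoly n (countSets P) μ                             ≡⟨ foldr-+≡sumℚ (λ k → fromℕ (countSets P k) * μ ^ k) ks ⟩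
  sumℚ (map (λ k → fromℕ (countSets P k) * μ ^ k) ks)    ≡⟨ sumℚ-cong coefficient ks ⟩
  sumℚ (map (λ k → sumℚ (map (term k) Ss)) ks)           ≡⟨ sumℚ-swap term ks Ss ⟩
  sumℚ (map (λ S → sumℚ (map (λ k → term k S) ks)) Ss)   ≡⟨ sumℚ-cong unique-size Ss ⟩
  sumℚ (map (λ S → if P S then μ ^ card S else 0ℚ) Ss)   ∎
  where
  open ≡-Reasoning
  ks = upTo (suc n)
  Ss = allSubsets n
  has-size : ℕ → Subset n → Bool
  has-size k S = P S ∧ ⌊ size S ℕ.≟ k ⌋
  term : ℕ → Subset n → ℚ
  term k S = if has-size k S then μ ^ k else 0ℚ
  indicator-scale : ∀ b c → c * (if b then 1ℚ else 0ℚ) ≡ (if b then c else 0ℚ)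
  indicator-scale true  c = ℚₚ.*-identityʳ c
  indicator-scale false c = ℚₚ.*-zeroʳ c
  coefficient : ∀ k → fromℕ (countSets P k) * μ ^ k ≡ sumℚ (map (term k) Ss)
  coefficient k = begin
    fromℕ (countSets P k) * μ ^ k                                 ≡⟨ ℚₚ.*-comm _ (μ ^ k) ⟩
    μ ^ k * fromℕ (countSets P k)                                 ≡⟨ cong (λ c → μ ^ k * fromℕ c) (length-filter (has-size k) Ss) ⟩
    μ ^ k * fromℕ (List.foldr (λ S → countStep (has-size k S)) 0 Ss) ≡⟨ cong (μ ^ k *_) (fromℕ-count (has-size k) Ss) ⟩
    μ ^ k * sumℚ (map (λ S → if has-size k S then 1ℚ else 0ℚ) Ss)  ≡⟨ sumℚ-scale (μ ^ k) _ Ss ⟨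
    sumℚ (map (λ S → μ ^ k * (if has-size k S then 1ℚ else 0ℚ)) Ss) ≡⟨ sumℚ-cong (λ S → indicator-scale (has-size k S) (μ ^ k)) Ss ⟩
    sumℚ (map (term k) Ss)                                        ∎
  unique-size : ∀ S → sumℚ (map (λ k → term k S) ks) ≡ (if P S then μ ^ card S else 0ℚ)
  unique-size S with P S
  ... | true  = trans (sum-pick-present (size S) (μ ^_) (suc n) (s≤s (subst (ℕ._≤ n) (sym (size≡card S)) (card≤ S))))
                      (cong (μ ^_) (size≡card S))
  ... | false = sumℚ-zero ks

evalPoly-nonNeg : ∀ n c {μ} → NonNeg μ → NonNeg (evalPoly n c μ)
evalPoly-nonNeg n c {μ} 0≤μ = go (upTo (suc n))
  where
  go : ∀ ks → NonNeg (List.foldr (λ k acc → fromℕ (c k) * μ ^ k +ℚ acc) 0ℚ ks)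
  go []       = ℚₚ.≤-refl
  go (k ∷ ks) = +-nonNeg (*-nonNeg (fromℕ-nonNeg (c k)) (^-nonNeg k 0≤μ)) (go ks)

meets-tabulate : ∀ {n} (S : Vec Bool n) (f : Fin n → Bool) → meets S (tabulate f) ≡ anyᶠ (λ u → lookup S u ∧ f u)
meets-tabulate S f = foldᶠ-cong _∨_ false (λ u → cong (lookup S u ∧_) (Vecₚ.lookup∘tabulate f u))

card-tabulate : ∀ {n} (f : Fin n → Bool) → card (tabulate f) ≡ countᶠ f
card-tabulate f = foldᶠ-cong countStep 0 (Vecₚ.lookup∘tabulate f)

system : ∀ {n} → (Fin n → Vec Bool n) → List (Constraint n)
system {n} N = map (λ v → (false , N v)) (allFin n)

satisfiesAll-system : ∀ {n} (N : Fin n → Vec Bool n) S → satisfiesAll S (system N) ≡ allᶠ (λ v → meets S (N v))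
satisfiesAll-system {n} N S = go (λ i → i)
  where
  go : ∀ {m} (t : Fin m → Fin n) → satisfiesAll S (map (λ v → (false , N v)) (List.tabulate t)) ≡ allᶠ (λ i → meets S (N (t i)))
  go {zero}  t = refl
  go {suc m} t = cong (meets S (N (t fzero)) ∧_) (go (t ∘ fsuc))

Symmetric : ∀ {n} → (Fin n → Vec Bool n) → Set
Symmetric N = ∀ u v → lookup (N v) u ≡ lookup (N u) v

multiplicity-system : ∀ {n} (N : Fin n → Vec Bool n) → Symmetric N → ∀ i → multiplicity i (system N) ≡ card (N i)
multiplicity-system {n} N sym-N i = go (λ v → v)
  where
  go : ∀ {m} (t : Fin m → Fin n) → multiplicity i (map (λ v → (false , N v)) (List.tabulate t)) ≡ countᶠ (lookup (N i) ∘ t)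
  go {zero}  t = refl
  go {suc m} t = cong₂ countStep (sym-N i (t fzero)) (go (t ∘ fsuc))

closedNbhd openNbhd : ∀ {n} → Graph n → Fin n → Vec Bool n
closedNbhd G v = tabulate (λ u → ⌊ u ≟ v ⌋ ∨ adj G u v)
openNbhd   G v = tabulate (λ u → adj G u v)

≟-sym : ∀ {n} (u v : Fin n) → ⌊ u ≟ v ⌋ ≡ ⌊ v ≟ u ⌋
≟-sym u v with u ≟ v | v ≟ u
... | yes _   | yes _   = refl
... | no  _   | no  _   = refl
... | yes u≡v | no  v≢u = ⊥-elim (v≢u (sym u≡v))
... | no  u≢v | yes v≡u = ⊥-elim (u≢v (sym v≡u))

-- ⌊_⌋ does not compute under map′, so the successor case of _≟_ is a lemma.
≟-suc : ∀ {n} (u v : Fin n) → ⌊ fsuc u ≟ fsuc v ⌋ ≡ ⌊ u ≟ v ⌋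
≟-suc u v with u ≟ v
... | yes _ = refl
... | no  _ = refl

anyᶠ-pick : ∀ {n} (q p : Fin n → Bool) v → anyᶠ (λ u → q u ∧ (⌊ u ≟ v ⌋ ∨ p u)) ≡ q v ∨ anyᶠ (λ u → q u ∧ p u)
anyᶠ-pick {suc n} q p fzero with q fzero
... | true  = refl
... | false = refl
anyᶠ-pick {suc n} q p (fsuc v) = begin
  (q fzero ∧ p fzero) ∨ anyᶠ (λ u → q (fsuc u) ∧ (⌊ fsuc u ≟ fsuc v ⌋ ∨ p (fsuc u)))
    ≡⟨ cong ((q fzero ∧ p fzero) ∨_) (foldᶠ-cong _∨_ false (λ u → cong (λ b → q (fsuc u) ∧ (b ∨ p (fsuc u))) (≟-suc u v))) ⟩
  (q fzero ∧ p fzero) ∨ anyᶠ (λ u → q (fsuc u) ∧ (⌊ u ≟ v ⌋ ∨ p (fsuc u)))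
    ≡⟨ cong ((q fzero ∧ p fzero) ∨_) (anyᶠ-pick (q ∘ fsuc) (p ∘ fsuc) v) ⟩
  (q fzero ∧ p fzero) ∨ (q (fsuc v) ∨ rest)   ≡⟨ 𝔹.∨-assoc (q fzero ∧ p fzero) (q (fsuc v)) rest ⟨
  ((q fzero ∧ p fzero) ∨ q (fsuc v)) ∨ rest   ≡⟨ cong (_∨ rest) (𝔹.∨-comm (q fzero ∧ p fzero) (q (fsuc v))) ⟩
  (q (fsuc v) ∨ (q fzero ∧ p fzero)) ∨ rest   ≡⟨ 𝔹.∨-assoc (q (fsuc v)) (q fzero ∧ p fzero) rest ⟩
  q (fsuc v) ∨ ((q fzero ∧ p fzero) ∨ rest)   ∎
  where
  open ≡-Reasoning
  rest = anyᶠ (λ u → q (fsuc u) ∧ p (fsuc u))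

countᶠ-pick : ∀ {n} (p : Fin n → Bool) v → p v ≡ false → countᶠ (λ u → ⌊ u ≟ v ⌋ ∨ p u) ≡ suc (countᶠ p)
countᶠ-pick {suc n} p fzero    pv≡false rewrite pv≡false = refl
countᶠ-pick {suc n} p (fsuc v) pv≡false =
  trans (cong (countStep (p fzero)) (foldᶠ-cong countStep 0 (λ u → cong (_∨ p (fsuc u)) (≟-suc u v))))
        (shift (p fzero))
  where
  shift : ∀ b → countStep b (countᶠ (λ u → ⌊ u ≟ v ⌋ ∨ p (fsuc u))) ≡ suc (countStep b (countᶠ (p ∘ fsuc)))
  shift true  = cong suc (countᶠ-pick (p ∘ fsuc) v pv≡false)
  shift false = countᶠ-pick (p ∘ fsuc) v pv≡false

isDominating-closedNbhd : ∀ {n} (G : Graph n) S → isDominating G S ≡ allᶠ (λ v → meets S (closedNbhd G v))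
isDominating-closedNbhd G S = trans (allV≡allᶠ (λ v → lookup S v ∨ anyV (λ u → lookup S u ∧ adj G u v))) (foldᶠ-cong _∧_ true λ v → begin
  lookup S v ∨ anyV (λ u → lookup S u ∧ adj G u v)  ≡⟨ cong (lookup S v ∨_) (anyV≡anyᶠ (λ u → lookup S u ∧ adj G u v)) ⟩
  lookup S v ∨ anyᶠ (λ u → lookup S u ∧ adj G u v)  ≡⟨ anyᶠ-pick (lookup S) (λ u → adj G u v) v ⟨
  anyᶠ (λ u → lookup S u ∧ (⌊ u ≟ v ⌋ ∨ adj G u v)) ≡⟨ meets-tabulate S (λ u → ⌊ u ≟ v ⌋ ∨ adj G u v) ⟨
  meets S (closedNbhd G v)                          ∎)
  where open ≡-Reasoning

isStrongDominating-openNbhd : ∀ {n} (G : Graph n) S → isStrongDominating G S ≡ allᶠ (λ v → meets S (openNbhd G v))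
isStrongDominating-openNbhd G S = trans (allV≡allᶠ (λ v → anyV (λ u → lookup S u ∧ adj G u v)))
  (foldᶠ-cong _∧_ true λ v → trans (anyV≡anyᶠ (λ u → lookup S u ∧ adj G u v)) (sym (meets-tabulate S (λ u → adj G u v))))

closedNbhd-symmetric : ∀ {n} (G : Graph n) → Symmetric (closedNbhd G)
closedNbhd-symmetric G u v = begin
  lookup (closedNbhd G v) u ≡⟨ Vecₚ.lookup∘tabulate _ u ⟩
  ⌊ u ≟ v ⌋ ∨ adj G u v     ≡⟨ cong₂ _∨_ (≟-sym u v) (adj-sym G u v) ⟩
  ⌊ v ≟ u ⌋ ∨ adj G v u     ≡⟨ Vecₚ.lookup∘tabulate _ v ⟨
  lookup (closedNbhd G u) v ∎
  where open ≡-Reasoning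

openNbhd-symmetric : ∀ {n} (G : Graph n) → Symmetric (openNbhd G)
openNbhd-symmetric G u v = trans (Vecₚ.lookup∘tabulate _ u)
  (trans (adj-sym G u v) (sym (Vecₚ.lookup∘tabulate _ v)))

module _ {n r} (G : Graph n) (regular : Regular r G) where

  card-openNbhd : ∀ v → card (openNbhd G v) ≡ r
  card-openNbhd v = begin
    card (openNbhd G v)       ≡⟨ card-tabulate (λ u → adj G u v) ⟩
    countᶠ (λ u → adj G u v)  ≡⟨ foldᶠ-cong countStep 0 (λ u → adj-sym G u v) ⟩
    countᶠ (adj G v)          ≡⟨ countV≡countᶠ (adj G v) ⟨
    degree G v                ≡⟨ regular v ⟩
    r                         ∎
    where open ≡-Reasoning

  card-closedNbhd : ∀ v → card (closedNbhd G v) ≡ suc r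
  card-closedNbhd v = begin
    card (closedNbhd G v)                      ≡⟨ card-tabulate (λ u → ⌊ u ≟ v ⌋ ∨ adj G u v) ⟩
    countᶠ (λ u → ⌊ u ≟ v ⌋ ∨ adj G u v)       ≡⟨ countᶠ-pick (λ u → adj G u v) v (adj-irrefl G v) ⟩
    suc (countᶠ (λ u → adj G u v))             ≡⟨ cong suc (trans (sym (card-tabulate (λ u → adj G u v))) (card-openNbhd v)) ⟩
    suc r                                      ∎
    where open ≡-Reasoning

allᶠ-sides : ∀ a b (g : Bool → Bool) → allᶠ {a + b} (λ v → g (toℕ v <ᵇ a)) ≡ allᶠ {a} (λ _ → g true) ∧ allᶠ {b} (λ _ → g false)
allᶠ-sides zero    b g = refl
allᶠ-sides (suc a) b g = trans (cong (g true ∧_) (allᶠ-sides a b g)) (sym (𝔹.∧-assoc (g true) _ _))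

countᶠ-sides : ∀ a b (g : Bool → Bool) → countᶠ {a + b} (λ v → g (toℕ v <ᵇ a)) ≡ countᶠ {a} (λ _ → g true) + countᶠ {b} (λ _ → g false)
countᶠ-sides zero    b g = refl
countᶠ-sides (suc a) b g = trans (cong (countStep (g true)) (countᶠ-sides a b g)) (step-+ (g true))
  where
  step-+ : ∀ c {x y} → countStep c (x + y) ≡ countStep c x + y
  step-+ true  = refl
  step-+ false = refl

-- The whole vertex set, which is every closed neighbourhood of a complete graph.
everything : ∀ m → Vec Bool m
everything m = tabulate (λ _ → true)

-- The sides of K_{r,r}: bipartSide r b is the open neighbourhood of every
-- vertex v with side v ≡ b (so bipartSide r false is the side of index < r).
bipartSide : ∀ r → Bool → Vec Bool (r + r)
bipartSide r b = tabulate (λ u → side {r} u xor b)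

card-bipartSide : ∀ r b → card (bipartSide r b) ≡ r
card-bipartSide r b = trans (card-tabulate (λ u → side {r} u xor b)) (trans (countᶠ-sides r r (_xor b)) (halves b))
  where
  halves : ∀ b → countᶠ {r} (λ _ → true xor b) + countᶠ {r} (λ _ → false xor b) ≡ r
  halves true  = cong₂ _+_ (countᶠ-const r false) (countᶠ-const r true)
  halves false = trans (cong₂ _+_ (countᶠ-const r true) (countᶠ-const r false)) (ℕₚ.+-identityʳ r)

module _ (μ : ℚ) (0≤μ : NonNeg μ) where
  open WeightedCount μ 0≤μ

  evalPoly-Z : ∀ n (P : Subset n → Bool) L → (∀ S → P S ≡ satisfiesAll S L) → evalPoly n (countSets P) μ ≡ Z n L
  evalPoly-Z n P L P≡ = trans (evalPoly-countSets n P μ)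
    (sumℚ-cong (λ S → cong (λ b → if b then μ ^ card S else 0ℚ) (P≡ S)) (allSubsets n))

  wΠ-system : ∀ {n} m (N : Fin n → Vec Bool n) → (∀ v → card (N v) ≡ m) → wΠ (system N) ≡ (u ^ m - 1ℚ) ^ n
  wΠ-system {n} m N |N|≡m = go (λ v → v)
    where
    go : ∀ {k} (t : Fin k → Fin n) → wΠ (map (λ v → (false , N v)) (List.tabulate t)) ≡ (u ^ m - 1ℚ) ^ k
    go {zero}  t = refl
    go {suc k} t = cong₂ (λ c x → (u ^ c - 1ℚ) * x) (|N|≡m (t fzero)) (go (t ∘ fsuc))

  system-bound : ∀ {n} k (N : Fin n → Vec Bool n) → Symmetric N → (∀ v → card (N v) ≡ suc k) →
                 (P : Subset n → Bool) → (∀ S → P S ≡ allᶠ (λ v → meets S (N v))) →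
                 evalPoly n (countSets P) μ ^ suc k ≤ (u ^ suc k - 1ℚ) ^ n
  system-bound {n} k N sym-N |N|≡ P P≡ = begin
    evalPoly n (countSets P) μ ^ suc k ≡⟨ cong (_^ suc k) (evalPoly-Z n P (system N) (λ S → trans (P≡ S) (sym (satisfiesAll-system N S)))) ⟩
    Z n (system N) ^ suc k             ≤⟨ Z-bound n k (system N) (λ i → trans (multiplicity-system N sym-N i) (|N|≡ i)) ⟩
    wΠ (system N)                      ≡⟨ wΠ-system (suc k) N |N|≡ ⟩
    (u ^ suc k - 1ℚ) ^ n               ∎
    where open ℚₚ.≤-Reasoning

  -- In K_{m+1} every closed neighbourhood is the whole vertex set, so the
  -- dominating sets are the nonempty sets: D_{K_{m+1}}(μ) = (1+μ)^{m+1} - 1.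
  D-complete : ∀ m → D (complete (suc m)) μ ≡ u ^ suc m - 1ℚ
  D-complete m = begin
    D K μ                           ≡⟨ evalPoly-Z (suc m) (isDominating K) L dominates⇔meets ⟩
    Z (suc m) L                     ≡⟨ Z-exact (suc m) L (λ i → cong (λ b → countStep b 0) (Vecₚ.lookup∘tabulate (λ _ → true) i)) ⟩
    (u ^ card (everything (suc m)) - 1ℚ) * 1ℚ ≡⟨ ℚₚ.*-identityʳ (u ^ card (everything (suc m)) - 1ℚ) ⟩
    u ^ card (everything (suc m)) - 1ℚ ≡⟨ cong (λ c → u ^ c - 1ℚ) (trans (card-tabulate {suc m} (λ _ → true)) (countᶠ-const (suc m) true)) ⟩
    u ^ suc m - 1ℚ                  ∎
    where
    open ≡-Reasoning
    K = complete (suc m)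
    L = (false , everything (suc m)) ∷ []
    dominates⇔meets : ∀ S → isDominating K S ≡ satisfiesAll S L
    dominates⇔meets S = begin
      isDominating K S                                  ≡⟨ isDominating-closedNbhd K S ⟩
      allᶠ (λ v → meets S (closedNbhd K v))             ≡⟨ foldᶠ-cong _∧_ true (λ v → cong (meets S)
                                                            (Vecₚ.tabulate-cong (λ u → 𝔹.∨-inverseʳ ⌊ u ≟ v ⌋))) ⟩
      allᶠ {suc m} (λ _ → meets S (everything (suc m))) ≡⟨ allᶠ-const m (meets S (everything (suc m))) ⟩
      meets S (everything (suc m))                      ≡⟨ 𝔹.∧-identityʳ (meets S (everything (suc m))) ⟨
      satisfiesAll S L                                  ∎

  -- In K_{r,r} the strong dominating sets are those meeting both sides,
  -- two independent constraints: D^s_{K_{r,r}}(μ) = ((1+μ)^r - 1)².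
  Ds-completeBipartite : ∀ r′ → Ds (completeBipartite (suc r′)) μ ≡ (u ^ suc r′ - 1ℚ) * (u ^ suc r′ - 1ℚ)
  Ds-completeBipartite r′ = begin
    Ds K μ          ≡⟨ evalPoly-Z (r + r) (isStrongDominating K) L strongly-dominates⇔meets ⟩
    Z (r + r) L     ≡⟨ Z-exact (r + r) L one-side ⟩
    (u ^ card (bipartSide r true) - 1ℚ) * ((u ^ card (bipartSide r false) - 1ℚ) * 1ℚ)
                    ≡⟨ cong₂ (λ a b → (u ^ a - 1ℚ) * ((u ^ b - 1ℚ) * 1ℚ)) (card-bipartSide r true) (card-bipartSide r false) ⟩
    (u ^ r - 1ℚ) * ((u ^ r - 1ℚ) * 1ℚ) ≡⟨ cong ((u ^ r - 1ℚ) *_) (ℚₚ.*-identityʳ (u ^ r - 1ℚ)) ⟩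
    (u ^ r - 1ℚ) * (u ^ r - 1ℚ)        ∎
    where
    open ≡-Reasoning
    r = suc r′
    K = completeBipartite r
    L = (false , bipartSide r true) ∷ (false , bipartSide r false) ∷ []
    strongly-dominates⇔meets : ∀ S → isStrongDominating K S ≡ satisfiesAll S L
    strongly-dominates⇔meets S = begin
      isStrongDominating K S                              ≡⟨ isStrongDominating-openNbhd K S ⟩
      allᶠ (λ v → meets S (bipartSide r (side {r} v)))   ≡⟨ allᶠ-sides r r (λ b → meets S (bipartSide r b)) ⟩
      allᶠ {r} (λ _ → meets S (bipartSide r true)) ∧ allᶠ {r} (λ _ → meets S (bipartSide r false))
                                                          ≡⟨ cong₂ _∧_ (allᶠ-const r′ (meets S (bipartSide r true)))
                                                                     (trans (allᶠ-const r′ (meets S (bipartSide r false))) (sym (𝔹.∧-identityʳ _))) ⟩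
      satisfiesAll S L                                    ∎
    one-side : ∀ i → multiplicity i L ≡ 1
    one-side i rewrite Vecₚ.lookup∘tabulate (λ u → side {r} u xor true) i
                     | Vecₚ.lookup∘tabulate (λ u → side {r} u xor false) i with side {r} i
    ... | true  = refl
    ... | false = refl

mainTheorem3 : (r : ℕ) → r ≥ 1 → (n : ℕ) → (G : Graph n) → Regular r G →
    (μ : ℚ) → 0ℚ < μ →
    ((D G μ) ^ (suc r) ≤ (D (complete (suc r)) μ) ^ n)
    × ((Ds G μ) ^ (r + r) ≤ (Ds (completeBipartite r) μ) ^ n)
mainTheorem3 (suc r′) (s≤s z≤n) n G regular μ μ>0 = dominating , strongly-dominating
  where
  r = suc r′
  0≤μ = ℚₚ.<⇒≤ μ>0
  dominating : D G μ ^ suc r ≤ D (complete (suc r)) μ ^ n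
  dominating = subst (λ d → D G μ ^ suc r ≤ d ^ n) (sym (D-complete μ 0≤μ r))
    (system-bound μ 0≤μ r (closedNbhd G) (closedNbhd-symmetric G) (card-closedNbhd G regular)
                  (isDominating G) (isDominating-closedNbhd G))
  strongly-dominating : Ds G μ ^ (r + r) ≤ Ds (completeBipartite r) μ ^ n
  strongly-dominating = subst (λ d → Ds G μ ^ (r + r) ≤ d ^ n) (sym (Ds-completeBipartite μ 0≤μ r′))
    (^-bound-squared r n (evalPoly-nonNeg n (sds G) 0≤μ)
      (system-bound μ 0≤μ r′ (openNbhd G) (openNbhd-symmetric G) (card-openNbhd G regular)
                    (isStrongDominating G) (isStrongDominating-openNbhd G)))
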